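{- Let $X$ be a finite abstract simplicial complex, viewed as a position in the simplicial take-away game, and let $x,y$ be two vertices of $X$ (i.e. $\{x\},\{y\}\in X$) forming a binary star, meaning: (i) $\{x,y\}\notin X$; (ii) for every $a\in X$ with $x\in a$, the set $(a\setminus\{x\})\cup\{y\}$ belongs to $X$; (iii) for every $a\in X$ with $y\in a$, the set $(a\setminus\{y\})\cup\{x\}$ belongs to $X$. Let $X'=\{a\in X : x\notin a \text{ and } y\notin a\}$. Then $X$ and $X'$ have the same win/loss value: $X$ is a first player win if and only if $X'$ is a first player win.
   Context: A finite abstract simplicial complex is a finite collection $X$ of non-empty finite sets such that every non-empty subset of a member of $X$ is again in $X$. The simplicial take-away game on a position $X$: two players alternate; a move consists of choosing a set $s\in X$ and replacing the position by $\{a\in X: s\not\subseteq a\}$ (i.e. erasing $s$ together with every set containing it). A player who cannot move (the position is empty) loses. Since the game is finite, every position is either a first player win (the player to move has a winning strategy) or a second player win. -}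

module Defs where

open import Data.Nat using (ℕ)
open import Data.Fin using (Fin)
open import Data.Fin.Subset using (Subset; _⊆_; _∈_; _∉_; _∪_; _-_; ⁅_⁆; Nonempty)
open import Data.Fin.Subset.Properties using (_⊆?_; _∈?_)
open import Data.Bool using (Bool; T; _∧_; not)
open import Data.Product using (Σ; _×_)
open import Relation.Nullary using (¬_)
open import Relation.Nullary.Decidable using (⌊_⌋)

-- A position (finite family of finite sets) over the vertex universe Fin n:
-- a decidable family of subsets of Fin n.  Finiteness is automatic.
Family : ℕ → Set
Family n = Subset n → Bool

_∈F_ : {n : ℕ} → Subset n → Family n → Set
a ∈F X = T (X a)

record IsSimplicialComplex {n : ℕ} (X : Family n) : Set where
  field
    nonempty : ∀ a → a ∈F X → Nonempty a
    downward : ∀ a b → a ∈F X → b ⊆ a → Nonempty b → b ∈F X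

erase : {n : ℕ} → Family n → Subset n → Family n
erase X s a = X a ∧ not ⌊ s ⊆? a ⌋

-- SecondWin X : every move from X leads to a FirstWin position
--               (in particular the empty position is a SecondWin).
data FirstWin {n : ℕ} (X : Family n) : Set
data SecondWin {n : ℕ} (X : Family n) : Set

data FirstWin {n} X where
  win : (s : Subset n) → s ∈F X → SecondWin (erase X s) → FirstWin X

data SecondWin {n} X where
  lose : ((s : Subset n) → s ∈F X → FirstWin (erase X s)) → SecondWin X

record BinaryStar {n : ℕ} (X : Family n) (x y : Fin n) : Set where
  field
    x-vertex : ⁅ x ⁆ ∈F X
    y-vertex : ⁅ y ⁆ ∈F X
    no-edge  : ¬ ((⁅ x ⁆ ∪ ⁅ y ⁆) ∈F X)
    x→y      : ∀ a → a ∈F X → x ∈ a → ((a - x) ∪ ⁅ y ⁆) ∈F X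
    y→x      : ∀ a → a ∈F X → y ∈ a → ((a - y) ∪ ⁅ x ⁆) ∈F X

removeStar : {n : ℕ} → Family n → Fin n → Fin n → Family n
removeStar X x y a = X a ∧ not ⌊ x ∈? a ⌋ ∧ not ⌊ y ∈? a ⌋

-- The two halves of a binary star mirror each other: erasing a set s ∋ x can be answered by
-- erasing its mirror image (s ∖ {x}) ∪ {y}, and this pair of moves changes neither the members
-- avoiding x and y nor the exchange symmetry of the position (no member contains both x and y,
-- and trading x for y, or y for x, in a member yields a member). Every other move of X is a move
-- of X' with the same effect there. So a player who wins on one position wins on the other by
-- answering each star move with its mirror image and copying all other moves.
{-# OPTIONS --safe #-}
module Submission where

open import Defs
open import Data.Nat using (ℕ; zero; suc; _+_; _≤_; _<_; z≤n; s≤s)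
open import Data.Nat.Properties using (≤-refl; <-trans; +-mono-≤; +-mono-<-≤; +-mono-≤-<)
open import Data.Nat.Induction using (<-wellFounded)
open import Induction.WellFounded using (Acc; acc)
open import Data.Fin using (Fin; _≟_)
open import Data.Fin.Subset using (Subset; _⊆_; _∈_; _∉_; _∪_; _─_; _-_; ⁅_⁆; inside; outside)
open import Data.Fin.Subset.Properties
  using (_⊆?_; _∈?_; x∈p∪q⁻; x∈p∪q⁺; x∈⁅x⁆; x∈⁅y⁆⇒x≡y; p─q⊆p; x∈p∧x≢y⇒x∈p-y; ⊆-refl)
open import Data.Vec using ([]; _∷_; here; there)
open import Data.Bool using (Bool; true; false; T; not)
open import Data.Bool.Properties using (T-∧)
open import Data.Unit using (tt)
open import Data.Empty using (⊥-elim)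
open import Data.Sum using (_⊎_; inj₁; inj₂; [_,_])
open import Data.Product using (_×_; _,_; proj₁; proj₂; ∃-syntax)
open import Function using (_∘_)
open import Function.Bundles using (_⇔_; mk⇔; Equivalence)
open import Relation.Nullary using (¬_; yes; no)
open import Relation.Nullary.Decidable using (⌊_⌋; toWitnessFalse; fromWitnessFalse; T?)
open import Relation.Binary.PropositionalEquality using (_≡_; _≢_; refl; sym)

open Equivalence using (to; from)

private
  variable
    n : ℕ
    i x y : Fin n
    a s : Subset n
    X Y Q : Family n

_⊆F_ : Family n → Family n → Set
Z ⊆F Y = ∀ {a} → a ∈F Z → a ∈F Y

∈-erase⁺ : a ∈F X → ¬ s ⊆ a → a ∈F erase X s
∈-erase⁺ {a = a} {X = X} {s = s} a∈X s⊈a =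
  from (T-∧ {X a}) (a∈X , fromWitnessFalse {a? = s ⊆? a} s⊈a)

∈-erase⁻ : a ∈F erase X s → a ∈F X × ¬ s ⊆ a
∈-erase⁻ {a = a} {X = X} {s = s} h with to (T-∧ {X a}) h
... | a∈X , s⊈a = a∈X , toWitnessFalse {a? = s ⊆? a} s⊈a

erase-⊆ : erase X s ⊆F X
erase-⊆ {X = X} {s = s} a∈ = proj₁ (∈-erase⁻ {X = X} {s = s} a∈)

∈-removeStar : a ∈F removeStar X x y ⇔ (a ∈F X × x ∉ a × y ∉ a)
∈-removeStar {a = a} {X = X} {x} {y} = mk⇔ split join
  where
  split : a ∈F removeStar X x y → a ∈F X × x ∉ a × y ∉ a
  split h with to (T-∧ {X a}) h
  ... | a∈X , avoid with to (T-∧ {not ⌊ x ∈? a ⌋}) avoid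
  ...   | x∉a , y∉a = a∈X , toWitnessFalse {a? = x ∈? a} x∉a , toWitnessFalse {a? = y ∈? a} y∉a
  join : a ∈F X × x ∉ a × y ∉ a → a ∈F removeStar X x y
  join (a∈X , x∉a , y∉a) =
    from (T-∧ {X a}) (a∈X , from (T-∧ {not ⌊ x ∈? a ⌋})
      (fromWitnessFalse {a? = x ∈? a} x∉a , fromWitnessFalse {a? = y ∈? a} y∉a))

bit : Bool → ℕ
bit true = 1
bit false = 0

count : Family n → ℕ
count {zero} Y = bit (Y [])
count {suc n} Y = count (Y ∘ (inside ∷_)) + count (Y ∘ (outside ∷_))

count-mono : (Z Y : Family n) → Z ⊆F Y → count Z ≤ count Y
count-mono {zero} Z Y Z⊆Y with Z [] | Y [] | Z⊆Y {[]}
... | false | _     | _   = z≤n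
... | true  | true  | _   = ≤-refl
... | true  | false | ⊆[] = ⊥-elim (⊆[] tt)
count-mono {suc n} Z Y Z⊆Y =
  +-mono-≤ (count-mono _ _ λ {a} → Z⊆Y {inside ∷ a}) (count-mono _ _ λ {a} → Z⊆Y {outside ∷ a})

count-strict : (Z Y : Family n) → Z ⊆F Y → s ∈F Y → ¬ s ∈F Z → count Z < count Y
count-strict {zero} {[]} Z Y Z⊆Y s∈Y s∉Z with Z [] | Y []
... | false | true = s≤s z≤n
... | true  | _    = ⊥-elim (s∉Z tt)
count-strict {suc n} {inside ∷ s} Z Y Z⊆Y s∈Y s∉Z =
  +-mono-<-≤ (count-strict _ _ (λ {a} → Z⊆Y {inside ∷ a}) s∈Y s∉Z)
             (count-mono _ _ λ {a} → Z⊆Y {outside ∷ a})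
count-strict {suc n} {outside ∷ s} Z Y Z⊆Y s∈Y s∉Z =
  +-mono-≤-< (count-mono _ _ λ {a} → Z⊆Y {inside ∷ a})
             (count-strict _ _ (λ {a} → Z⊆Y {outside ∷ a}) s∈Y s∉Z)

count-erase : s ∈F Y → count (erase Y s) < count Y
count-erase {s = s} {Y = Y} s∈Y =
  count-strict (erase Y s) Y (erase-⊆ {X = Y}) s∈Y (λ s∈ → proj₂ (∈-erase⁻ {X = Y} s∈) ⊆-refl)

record IsMirroring (_≈_ : Family n → Family n → Set) : Set where
  field
    common : Y ≈ Q → s ∈F Q → s ∈F Y × erase Y s ≈ erase Q s
    reply  : Y ≈ Q → s ∈F Y → ¬ s ∈F Q → ∃[ t ] t ∈F erase Y s × erase (erase Y s) t ≈ Q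

module Mirroring {_≈_ : Family n → Family n → Set} (M : IsMirroring _≈_) where
  open IsMirroring M

  firstWin⁺ : Y ≈ Q → FirstWin Y → FirstWin Q
  secondWin⁺ : Y ≈ Q → SecondWin Y → SecondWin Q
  firstWin⁻ : Y ≈ Q → Acc _<_ (count Y) → FirstWin Q → FirstWin Y
  secondWin⁻ : Y ≈ Q → Acc _<_ (count Y) → SecondWin Q → SecondWin Y
  firstWin⁻-erase : Y ≈ Q → Acc _<_ (count Y) → SecondWin Q → s ∈F Y → FirstWin (erase Y s)

  firstWin⁺ {Q = Q} Y≈Q (win s s∈Y lost) with T? (Q s)
  ... | yes s∈Q = win s s∈Q (secondWin⁺ (proj₂ (common Y≈Q s∈Q)) lost)
  ... | no s∉Q with reply Y≈Q s∈Y s∉Q | lost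
  ...   | t , t∈ , ≈Q | lose wins = firstWin⁺ ≈Q (wins t t∈)

  secondWin⁺ Y≈Q (lose wins) = lose λ s s∈Q →
    let s∈Y , ≈erase = common Y≈Q s∈Q in firstWin⁺ ≈erase (wins s s∈Y)

  firstWin⁻ {Y = Y} Y≈Q (acc rs) (win s s∈Q lost) =
    let s∈Y , ≈erase = common Y≈Q s∈Q
    in win s s∈Y (secondWin⁻ ≈erase (rs (count-erase {Y = Y} s∈Y)) lost)

  -- The losing strategy for Q is reused after a move and its reply, so this direction
  -- recurses on the number of members of Y rather than on the strategy.
  secondWin⁻ Y≈Q accessible lost = lose λ s s∈Y → firstWin⁻-erase Y≈Q accessible lost s∈Y

  firstWin⁻-erase {Y = Y} {Q = Q} {s = s} Y≈Q (acc rs) (lose wins) s∈Y with T? (Q s)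
  ... | yes s∈Q = firstWin⁻ (proj₂ (common Y≈Q s∈Q)) (rs (count-erase {Y = Y} s∈Y)) (wins s s∈Q)
  ... | no s∉Q with reply Y≈Q s∈Y s∉Q
  ...   | t , t∈ , ≈Q =
    let fewer = <-trans (count-erase {Y = erase Y s} t∈) (count-erase {Y = Y} s∈Y)
    in win t t∈ (secondWin⁻ ≈Q (rs fewer) (lose wins))

  firstWin⇔ : Y ≈ Q → FirstWin Y ⇔ FirstWin Q
  firstWin⇔ {Y = Y} Y≈Q = mk⇔ (firstWin⁺ Y≈Q) (firstWin⁻ Y≈Q (<-wellFounded (count Y)))

x∈p─q⇒x∉q : (p q : Subset n) → i ∈ p ─ q → i ∉ q
x∈p─q⇒x∉q (_ ∷ p) (inside ∷ q) ()        here
x∈p─q⇒x∉q (_ ∷ p) (_ ∷ q)      (there h) (there h′) = x∈p─q⇒x∉q p q h h′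

x∈p∧y∈p⇒⁅x⁆∪⁅y⁆⊆p : x ∈ a → y ∈ a → ⁅ x ⁆ ∪ ⁅ y ⁆ ⊆ a
x∈p∧y∈p⇒⁅x⁆∪⁅y⁆⊆p {x = x} {y = y} x∈a y∈a h with x∈p∪q⁻ ⁅ x ⁆ ⁅ y ⁆ h
... | inj₁ h₁ rewrite x∈⁅y⁆⇒x≡y x h₁ = x∈a
... | inj₂ h₂ rewrite x∈⁅y⁆⇒x≡y y h₂ = y∈a

replace : Subset n → Fin n → Fin n → Subset n
replace a x y = (a - x) ∪ ⁅ y ⁆

∈-replace⁻ : i ∈ replace a x y → (i ∈ a × i ≢ x) ⊎ i ≡ y
∈-replace⁻ {a = a} {x} {y} h with x∈p∪q⁻ (a - x) ⁅ y ⁆ h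
... | inj₁ i∈a-x = inj₁ (p─q⊆p a ⁅ x ⁆ i∈a-x , λ { refl → x∈p─q⇒x∉q a ⁅ x ⁆ i∈a-x (x∈⁅x⁆ x) })
... | inj₂ i∈⁅y⁆ = inj₂ (x∈⁅y⁆⇒x≡y y i∈⁅y⁆)

∈-replace⁺ : i ∈ a → i ≢ x → i ∈ replace a x y
∈-replace⁺ i∈a i≢x = x∈p∪q⁺ (inj₁ (x∈p∧x≢y⇒x∈p-y i∈a i≢x))

y∈replace : y ∈ replace a x y
y∈replace {y = y} = x∈p∪q⁺ (inj₂ (x∈⁅x⁆ y))

x∉replace : x ≢ y → x ∉ replace a x y
x∉replace x≢y h = [ (λ (_ , x≢x) → x≢x refl) , x≢y ] (∈-replace⁻ h)

∈-replace-≢ : i ∈ replace a x y → i ≢ y → i ∈ a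
∈-replace-≢ h i≢y = [ proj₁ , ⊥-elim ∘ i≢y ] (∈-replace⁻ h)

⊆-replace⇒⊆ : y ∉ s → s ⊆ replace a x y → s ⊆ a
⊆-replace⇒⊆ y∉s s⊆ i∈s = ∈-replace-≢ (s⊆ i∈s) λ { refl → y∉s i∈s }

replace-⊆-replace⇒⊆ : x ∈ a → y ∉ s → replace s x y ⊆ replace a x y → s ⊆ a
replace-⊆-replace⇒⊆ {x = x} x∈a y∉s ⊆ {i} i∈s with i ≟ x
... | yes refl = x∈a
... | no i≢x = ∈-replace-≢ (⊆ (∈-replace⁺ i∈s i≢x)) λ { refl → y∉s i∈s }

⊆-replace⇒replace-⊆ : y ∈ a → s ⊆ replace a y x → replace s x y ⊆ a
⊆-replace⇒replace-⊆ y∈a ⊆ h with ∈-replace⁻ h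
... | inj₁ (i∈s , i≢x) = ∈-replace-≢ (⊆ i∈s) i≢x
... | inj₂ refl = y∈a

record Exchangeable (Y : Family n) (x y : Fin n) : Set where
  field
    apart : a ∈F Y → x ∈ a → y ∉ a
    x↦y   : a ∈F Y → x ∈ a → replace a x y ∈F Y
    y↦x   : a ∈F Y → y ∈ a → replace a y x ∈F Y

open Exchangeable

exchangeable-sym : Exchangeable Y x y → Exchangeable Y y x
exchangeable-sym E = record
  { apart = λ a∈Y y∈a x∈a → apart E a∈Y x∈a y∈a ; x↦y = y↦x E ; y↦x = x↦y E }

exchangeable-erase : Exchangeable Y x y → x ∉ s → y ∉ s → Exchangeable (erase Y s) x y
exchangeable-erase {Y = Y} E x∉s y∉s = record
  { apart = apart E ∘ erase-⊆ {X = Y}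
  ; x↦y = λ a∈ x∈a → let a∈Y , s⊈a = ∈-erase⁻ {X = Y} a∈ in
      ∈-erase⁺ {X = Y} (x↦y E a∈Y x∈a) (s⊈a ∘ ⊆-replace⇒⊆ y∉s)
  ; y↦x = λ a∈ y∈a → let a∈Y , s⊈a = ∈-erase⁻ {X = Y} a∈ in
      ∈-erase⁺ {X = Y} (y↦x E a∈Y y∈a) (s⊈a ∘ ⊆-replace⇒⊆ x∉s)
  }

module _ {Y : Family n} {x y : Fin n} {s : Subset n}
         (E : Exchangeable Y x y) (s∈Y : s ∈F Y) (x∈s : x ∈ s) where

  private
    y∉s : y ∉ s
    y∉s = apart E s∈Y x∈s

    x≢y : x ≢ y
    x≢y refl = y∉s x∈s

    t : Subset n
    t = replace s x y

  mirror-∈ : t ∈F erase Y s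
  mirror-∈ = ∈-erase⁺ {X = Y} (x↦y E s∈Y x∈s) λ s⊆t → x∉replace x≢y (s⊆t x∈s)

  ∈-mirror⁺ : a ∈F Y → ¬ s ⊆ a → ¬ t ⊆ a → a ∈F erase (erase Y s) t
  ∈-mirror⁺ a∈Y s⊈a t⊈a = ∈-erase⁺ {X = erase Y s} (∈-erase⁺ {X = Y} a∈Y s⊈a) t⊈a

  ∈-mirror⁻ : a ∈F erase (erase Y s) t → a ∈F Y × ¬ s ⊆ a × ¬ t ⊆ a
  ∈-mirror⁻ a∈ =
    let a∈Y-s , t⊈a = ∈-erase⁻ {X = erase Y s} a∈
        a∈Y , s⊈a = ∈-erase⁻ {X = Y} a∈Y-s
    in a∈Y , s⊈a , t⊈a

  exchangeable-mirror : Exchangeable (erase (erase Y s) t) x y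
  exchangeable-mirror = record
    { apart = λ a∈ → apart E (proj₁ (∈-mirror⁻ a∈))
    ; x↦y = λ {a} a∈ x∈a → let a∈Y , s⊈a , _ = ∈-mirror⁻ a∈ in
        ∈-mirror⁺ (x↦y E a∈Y x∈a) (λ s⊆ → x∉replace x≢y (s⊆ x∈s))
                  (s⊈a ∘ replace-⊆-replace⇒⊆ x∈a y∉s)
    ; y↦x = λ {a} a∈ y∈a → let a∈Y , _ , t⊈a = ∈-mirror⁻ a∈ in
        ∈-mirror⁺ (y↦x E a∈Y y∈a) (t⊈a ∘ ⊆-replace⇒replace-⊆ y∈a)
                  (λ t⊆ → x∉replace (x≢y ∘ sym) (t⊆ y∈replace))
    }

record StarRemoval (x y : Fin n) (Y Q : Family n) : Set where
  field
    exchangeable : Exchangeable Y x y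
    members      : a ∈F Q ⇔ (a ∈F Y × x ∉ a × y ∉ a)

open StarRemoval

starRemoval-sym : StarRemoval x y Y Q → StarRemoval y x Y Q
starRemoval-sym R = record
  { exchangeable = exchangeable-sym (exchangeable R)
  ; members = mk⇔ (swap ∘ to (members R)) (from (members R) ∘ swap)
  }
  where
  swap : ∀ {A B C : Set} → A × B × C → A × C × B
  swap (p , q , r) = p , r , q

starRemoval-erase : StarRemoval x y Y Q → x ∉ s → y ∉ s → StarRemoval x y (erase Y s) (erase Q s)
starRemoval-erase {Y = Y} {Q = Q} R x∉s y∉s = record
  { exchangeable = exchangeable-erase (exchangeable R) x∉s y∉s
  ; members = mk⇔
      (λ a∈ → let a∈Q , s⊈a = ∈-erase⁻ {X = Q} a∈
                  a∈Y , x∉a , y∉a = to (members R) a∈Q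
              in ∈-erase⁺ {X = Y} a∈Y s⊈a , x∉a , y∉a)
      (λ (a∈ , x∉a , y∉a) → let a∈Y , s⊈a = ∈-erase⁻ {X = Y} a∈ in
          ∈-erase⁺ {X = Q} (from (members R) (a∈Y , x∉a , y∉a)) s⊈a)
  }

starRemoval-mirror : StarRemoval x y Y Q → s ∈F Y → x ∈ s →
  StarRemoval x y (erase (erase Y s) (replace s x y)) Q
starRemoval-mirror R s∈Y x∈s = record
  { exchangeable = exchangeable-mirror (exchangeable R) s∈Y x∈s
  ; members = mk⇔
      (λ a∈Q → let a∈Y , x∉a , y∉a = to (members R) a∈Q in
         ∈-mirror⁺ (exchangeable R) s∈Y x∈s a∈Y
           (λ s⊆a → x∉a (s⊆a x∈s)) (λ t⊆a → y∉a (t⊆a y∈replace)) , x∉a , y∉a)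
      (λ (a∈ , x∉a , y∉a) →
         from (members R) (proj₁ (∈-mirror⁻ (exchangeable R) s∈Y x∈s a∈) , x∉a , y∉a))
  }

starRemoval-isMirroring : IsMirroring (StarRemoval {n} x y)
starRemoval-isMirroring = record { common = common ; reply = reply }
  where
  common : StarRemoval x y Y Q → s ∈F Q → s ∈F Y × StarRemoval x y (erase Y s) (erase Q s)
  common R s∈Q = let s∈Y , x∉s , y∉s = to (members R) s∈Q in s∈Y , starRemoval-erase R x∉s y∉s

  reply : StarRemoval x y Y Q → s ∈F Y → ¬ s ∈F Q →
    ∃[ t ] t ∈F erase Y s × StarRemoval x y (erase (erase Y s) t) Q
  reply {x = x} {y = y} {s = s} R s∈Y s∉Q with x ∈? s | y ∈? s
  ... | yes x∈s | _ =
    replace s x y , mirror-∈ (exchangeable R) s∈Y x∈s , starRemoval-mirror R s∈Y x∈s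
  ... | no _ | yes y∈s =
    replace s y x , mirror-∈ (exchangeable-sym (exchangeable R)) s∈Y y∈s ,
    starRemoval-sym (starRemoval-mirror (starRemoval-sym R) s∈Y y∈s)
  ... | no x∉s | no y∉s = ⊥-elim (s∉Q (from (members R) (s∈Y , x∉s , y∉s)))

binaryStar-exchangeable : IsSimplicialComplex X → BinaryStar X x y → Exchangeable X x y
binaryStar-exchangeable {x = x} C B = record
  { apart = λ {a} a∈X x∈a y∈a →
      no-edge (downward a _ a∈X (x∈p∧y∈p⇒⁅x⁆∪⁅y⁆⊆p x∈a y∈a) (x , x∈p∪q⁺ (inj₁ (x∈⁅x⁆ x))))
  ; x↦y = x→y _
  ; y↦x = y→x _
  }
  where
  open IsSimplicialComplex C
  open BinaryStar B

mainTheorem1 : (n : ℕ) (X : Family n) (x y : Fin n) →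
    IsSimplicialComplex X → BinaryStar X x y →
    FirstWin X ⇔ FirstWin (removeStar X x y)
mainTheorem1 n X x y C B = Mirroring.firstWin⇔ starRemoval-isMirroring removal
  where
  removal : StarRemoval x y X (removeStar X x y)
  removal = record { exchangeable = binaryStar-exchangeable C B ; members = ∈-removeStar {X = X} }
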